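{- Let $p$ be a prime and $r\ge1$ an integer. Let $\gamma$ be a path of length $m$ in $\mathscr{E}_{p^{r-1}}$ with initial vertex $v$, and let $\bar v$ be a lift of $v$ to $\mathscr{E}_{p^r}$. Then there are precisely $p^m$ different lifts of $\gamma$ to $\mathscr{E}_{p^r}$ with initial vertex $\bar v$.
   Context: For a positive integer $n$, $\mathscr{E}_n$ is the directed graph whose vertices are the pairs $(a,b)$ with $a,b\in\{0,\dots,n-1\}$ and $\gcd(a,b,n)=1$, written $a/b$, with a directed edge $a/b\to c/d$ iff $ad-bc\equiv1\pmod n$. A path of length $m$ is a sequence of vertices $\langle v_0,\dots,v_m\rangle$ with a directed edge $v_{i-1}\to v_i$ for each $i$. The map $\theta\colon\mathscr{E}_{p^r}\to\mathscr{E}_{p^{r-1}}$ sends $a/b$ to $(a\bmod p^{r-1})/(b\bmod p^{r-1})$. A lift of a vertex $v$ of $\mathscr{E}_{p^{r-1}}$ is a vertex $w$ of $\mathscr{E}_{p^r}$ with $\theta(w)=v$; a lift of a path $\langle v_0,\dots,v_m\rangle$ is a path $\langle w_0,\dots,w_m\rangle$ in $\mathscr{E}_{p^r}$ with $\theta(w_i)=v_i$ for all $i$. -}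

module Defs where

open import Data.Nat using (ℕ; suc; _^_; _∸_; NonZero)
open import Data.Nat.GCD using (gcd)
open import Data.Nat.DivMod using (_mod_)
open import Data.Nat.Primality using (Prime; prime⇒nonZero)
open import Data.Nat.Properties using (m^n≢0)
open import Data.Fin using (Fin; toℕ; zero)
open import Data.Integer as ℤ using (ℤ; +_)
open import Data.Integer.Divisibility using (_∣_)
open import Data.Product using (_×_; _,_)
open import Data.Vec using (Vec; []; _∷_; head)
open import Relation.Binary.PropositionalEquality using (_≡_)

-- A pair a/b with a, b ∈ {0, …, n-1}
Pair : ℕ → Set
Pair n = Fin n × Fin n

IsVertex : (n : ℕ) → Pair n → Set
IsVertex n (a , b) = gcd (gcd (toℕ a) (toℕ b)) n ≡ 1

Edge : (n : ℕ) → Pair n → Pair n → Set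
Edge n (a , b) (c , d) =
  (+ n) ∣ ((+ toℕ a) ℤ.* (+ toℕ d) ℤ.- (+ toℕ b) ℤ.* (+ toℕ c) ℤ.- ℤ.1ℤ)

Chain : (n : ℕ) {m : ℕ} → Vec (Pair n) (suc m) → Set
Chain n (x ∷ []) = Data.Unit.⊤
  where import Data.Unit
Chain n (x ∷ y ∷ ys) = Edge n x y × Chain n (y ∷ ys)

AllVertices : (n : ℕ) {k : ℕ} → Vec (Pair n) k → Set
AllVertices n [] = Data.Unit.⊤
  where import Data.Unit
AllVertices n (x ∷ xs) = IsVertex n x × AllVertices n xs

IsPath : (n : ℕ) {m : ℕ} → Vec (Pair n) (suc m) → Set
IsPath n γ = AllVertices n γ × Chain n γ

θ : {p : ℕ} → Prime p → (r : ℕ) → Pair (p ^ r) → Pair (p ^ (r ∸ 1))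
θ {p} pp r (a , b) = (toℕ a mod (p ^ (r ∸ 1))) , (toℕ b mod (p ^ (r ∸ 1)))
  where instance
          nzp : NonZero p
          nzp = prime⇒nonZero pp
          nzq : NonZero (p ^ (r ∸ 1))
          nzq = m^n≢0 p (r ∸ 1)

θ* : {p : ℕ} → Prime p → (r : ℕ) {k : ℕ} → Vec (Pair (p ^ r)) k → Vec (Pair (p ^ (r ∸ 1))) k
θ* pp r [] = []
θ* pp r (x ∷ xs) = θ pp r x ∷ θ* pp r xs

IsLift : {p : ℕ} → Prime p → (r : ℕ) {m : ℕ} →
         Vec (Pair (p ^ (r ∸ 1))) (suc m) → Vec (Pair (p ^ r)) (suc m) → Set
IsLift pp r γ w = IsPath _ w × θ* pp r w ≡ γ

{-# OPTIONS --safe #-}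
module Submission where

-- Write q = p^(r-1). Let a/b be a vertex of 𝓔_{pq} whose reduction has an edge to c/d in 𝓔_q,
-- so ad - bc - 1 = qK. The lifts of c/d are (c + qs)/(d + qt) with s, t < p, and
--   a(d + qt) - b(c + qs) - 1 = q(K + at - bs),
-- so a/b → (c + qs)/(d + qt) in 𝓔_{pq} iff K + at - bs ≡ 0 (mod p). As gcd(a, b, pq) = 1, p does
-- not divide both a and b, so this congruence has one solution for each value of the other
-- unknown: p solutions in all. The end of a lifted edge is again a vertex, so lifting γ edge by
-- edge from v̄ gives exactly p^m lifts.

open import Defs
open import Data.Empty using (⊥-elim)
open import Data.Fin using (Fin; toℕ; fromℕ<; punchOut; combine; quotient; remainder)
open import Data.Fin.Properties
  using (any?; _≟_; injective⇒≤; punchOut-injective; toℕ-injective; toℕ<n; toℕ-fromℕ<;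
         toℕ-combine; combine-remQuot; combine-injectiveˡ)
open import Data.Integer using (ℤ; +_; -_; _+_; _-_; _*_; ∣_∣; 0ℤ; 1ℤ)
open import Data.Integer.DivMod using (_%ℕ_; _/ℕ_; n%ℕd<d; a≡a%ℕn+[a/ℕn]*n)
open import Data.Integer.Divisibility.Signed
  using (_∣_; divides; ∣ᵤ⇒∣; ∣⇒∣ᵤ; ∣-trans; ∣m∣n⇒∣m+n; ∣m∣n⇒∣m-n; ∣m+n∣m⇒∣n; ∣m⇒∣-m;
         ∣n⇒∣m*n; ∣m⇒∣m*n; *-monoʳ-∣; *-cancelˡ-∣)
open import Data.Integer.Properties
  using (abs-*; pos-+; pos-*; *-comm; +-identityʳ; m-n≡m⊖n; ∣m⊝n∣≤m⊔n; ∣i∣≡0⇒i≡0; ∣-i∣≡∣i∣;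
         i-j≡0⇒i≡j; +-injective)
open import Data.Integer.Tactic.RingSolver using (solve-∀)
open import Data.List using (List; []; _∷_; map; length; allFin; concatMap; filter; cartesianProduct)
open import Data.List.Membership.Propositional using (_∈_; find; lose)
open import Data.List.Membership.Propositional.Properties
  using (∈-map⁺; ∈-map⁻; ∈-allFin; ∈-concatMap⁺; ∈-concatMap⁻; ∈-filter⁺; ∈-filter⁻; ∈-cartesianProduct⁺)
open import Data.List.Membership.Propositional.Properties.WithK using (unique∧set⇒bag)
open import Data.List.Properties using (length-map; length-tabulate; length-++)
open import Data.List.Relation.Binary.BagAndSetEquality using (∼bag⇒↭)
open import Data.List.Relation.Binary.Permutation.Propositional.Properties using (↭-length)
import Data.List.Relation.Unary.All as All
open import Data.List.Relation.Unary.AllPairs using ([]; _∷_)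
open import Data.List.Relation.Unary.Any using (here; there)
open import Data.List.Relation.Unary.Unique.Propositional using (Unique)
import Data.List.Relation.Unary.Unique.Propositional.Properties as Unique
open import Data.Nat as ℕ using (ℕ; zero; suc; _^_; _∸_; _≤_; NonZero)
import Data.Nat.Divisibility as ℕ
open import Data.Nat.DivMod using (_mod_; m%n<n; m<n⇒m%n≡m; [m+kn]%n≡m%n)
open import Data.Nat.GCD using (gcd; gcd[m,n]∣m; gcd[m,n]∣n; gcd-greatest)
open import Data.Nat.Primality using (Prime; prime⇒nonZero; euclidsLemma; ¬prime[1])
import Data.Nat.Properties as ℕ
open import Data.Product using (Σ; ∃; _×_; _,_; proj₁; proj₂; swap)
open import Data.Product.Properties using (≡-dec)
open import Data.Sum as Sum using (_⊎_; inj₁; inj₂)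
open import Data.Unit using (tt)
open import Data.Vec using (Vec; []; _∷_; head; tail)
open import Data.Vec.Properties using (∷-injectiveˡ; ∷-injectiveʳ)
open import Function.Base using (_∘_; id)
open import Function.Bundles using (_⇔_; mk⇔; Equivalence)
open import Function.Definitions using (Injective)
import Function.Properties.Equivalence as ⇔
open import Relation.Binary.Definitions using (Decidable)
open import Relation.Binary.PropositionalEquality
open import Relation.Nullary using (¬_; Dec; yes; no; contradiction)
open import Relation.Nullary.Decidable using (_×-dec_)

injective⇒surjective : ∀ {n} {f : Fin n → Fin n} → Injective _≡_ _≡_ f → ∀ j → ∃ λ i → f i ≡ j
injective⇒surjective {suc n} {f} f-injective j with any? (λ i → f i ≟ j)
... | yes hit = hit
... | no miss = contradiction (injective⇒≤ punchOut∘f-injective) ℕ.1+n≰n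
  where
  j≢f : ∀ i → j ≢ f i
  j≢f i j≡fi = miss (i , sym j≡fi)

  punchOut∘f : Fin (suc n) → Fin n
  punchOut∘f i = punchOut (j≢f i)

  punchOut∘f-injective : Injective _≡_ _≡_ punchOut∘f
  punchOut∘f-injective eq = f-injective (punchOut-injective (j≢f _) (j≢f _) eq)

record Enumeration {A : Set} (P : A → Set) (n : ℕ) : Set where
  field
    element : Fin n → A
    element-injective : Injective _≡_ _≡_ element
    element-sound : ∀ i → P (element i)
    element-complete : ∀ {x} → P x → ∃ λ i → element i ≡ x

module _ {A : Set} {P : A → Set} {n : ℕ} where

  Enumeration⇒length≡ : ∀ {xs} → Unique xs → (∀ {x} → x ∈ xs ⇔ P x) → Enumeration P n → length xs ≡ n
  Enumeration⇒length≡ {xs} xs-unique xs⇔P e = begin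
    length xs          ≡⟨ ↭-length (∼bag⇒↭ (unique∧set⇒bag xs-unique elements-unique xs∼elements)) ⟩
    length elements    ≡⟨ length-map element (allFin n) ⟩
    length (allFin n)  ≡⟨ length-tabulate {n = n} id ⟩
    n                  ∎
    where
    open ≡-Reasoning
    open Enumeration e

    elements : List A
    elements = map element (allFin n)

    elements-unique : Unique elements
    elements-unique = Unique.map⁺ element-injective (Unique.allFin⁺ n)

    ∈-elements⇔ : ∀ {x} → x ∈ elements ⇔ P x
    ∈-elements⇔ = mk⇔
      (λ x∈ → let i , _ , x≡ = ∈-map⁻ element x∈ in subst P (sym x≡) (element-sound i))
      (λ Px → let i , eq = element-complete Px in subst (_∈ elements) eq (∈-map⁺ element (∈-allFin i)))

    xs∼elements : ∀ {x} → x ∈ xs ⇔ x ∈ elements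
    xs∼elements = ⇔.trans xs⇔P (⇔.sym ∈-elements⇔)

module _ {A B : Set} {P : A → Set} {Q : B → Set} {n : ℕ} where

  Enumeration-image : (g : A → B) → Injective _≡_ _≡_ g →
                      (∀ {x} → P x → Q (g x)) → (∀ {x} → Q (g x) → P x) → (∀ {y} → Q y → ∃ λ x → g x ≡ y) →
                      Enumeration P n → Enumeration Q n
  Enumeration-image g g-injective P⇒Q∘g Q∘g⇒P onto e = record
    { element = g ∘ element
    ; element-injective = element-injective ∘ g-injective
    ; element-sound = P⇒Q∘g ∘ element-sound
    ; element-complete = λ {y} Qy →
        let x , gx≡y = onto Qy
            i , eᵢ≡x = element-complete (Q∘g⇒P (subst Q (sym gx≡y) Qy))
        in i , trans (cong g eᵢ≡x) gx≡y
    }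
    where open Enumeration e

module _ {B : Set} {n : ℕ} {P : Fin n × B → Set} where

  graph-Enumeration : (∀ s → ∃ λ t → P (s , t)) → (∀ {s t t′} → P (s , t) → P (s , t′) → t ≡ t′) →
                      Enumeration P n
  graph-Enumeration exists unique = record
    { element = λ s → s , proj₁ (exists s)
    ; element-injective = cong proj₁
    ; element-sound = λ s → proj₂ (exists s)
    ; element-complete = λ {(s , t)} Pst → s , cong (s ,_) (unique (proj₂ (exists s)) Pst)
    }

module _ {A B : Set} (f : A → List B) where

  length-concatMap : ∀ {xs c} → (∀ {x} → x ∈ xs → length (f x) ≡ c) →
                     length (concatMap f xs) ≡ length xs ℕ.* c
  length-concatMap {[]}     _       = refl
  length-concatMap {x ∷ xs} lengths =
    trans (length-++ (f x)) (cong₂ ℕ._+_ (lengths (here refl)) (length-concatMap (lengths ∘ there)))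

  Unique-concatMap : ∀ {xs} → Unique xs → (∀ x → Unique (f x)) →
                     (∀ {x x′ y} → y ∈ f x → y ∈ f x′ → x ≡ x′) → Unique (concatMap f xs)
  Unique-concatMap []                  _        _        = []
  Unique-concatMap {x ∷ xs} (x∉xs ∷ xs-unique) f-unique disjoint =
    Unique.++⁺ (f-unique x) (Unique-concatMap xs-unique f-unique disjoint) fx#rest
    where
    fx#rest : ∀ {y} → ¬ (y ∈ f x × y ∈ concatMap f xs)
    fx#rest (y∈fx , y∈rest) =
      let x′ , x′∈xs , y∈fx′ = find (∈-concatMap⁻ f y∈rest) in All.lookup x∉xs x′∈xs (disjoint y∈fx y∈fx′)

⟦_⟧ : ∀ {n} → Fin n → ℤ
⟦ i ⟧ = + toℕ i

module _ {n : ℕ} .{{_ : NonZero n}} where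

  ∣-%ℕ : ∀ α → + n ∣ α - + (α %ℕ n)
  ∣-%ℕ α = divides (α /ℕ n) (begin
    α - + (α %ℕ n)                            ≡⟨ cong (_- + (α %ℕ n)) (a≡a%ℕn+[a/ℕn]*n α n) ⟩
    + (α %ℕ n) + (α /ℕ n) * + n - + (α %ℕ n)  ≡⟨ r+x-r≡x (+ (α %ℕ n)) ((α /ℕ n) * + n) ⟩
    (α /ℕ n) * + n                            ∎)
    where
    open ≡-Reasoning
    r+x-r≡x : ∀ r x → r + x - r ≡ x
    r+x-r≡x = solve-∀

  residue : ℤ → Fin n
  residue α = fromℕ< (n%ℕd<d α n)

  residue-≡⇒∣ : ∀ α β → residue α ≡ residue β → + n ∣ α - β
  residue-≡⇒∣ α β eq = subst (+ n ∣_) (x-r-[y-r]≡x-y α β (+ (α %ℕ n)))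
    (∣m∣n⇒∣m-n (∣-%ℕ α) (subst (λ r → + n ∣ β - + r) (sym α%n≡β%n) (∣-%ℕ β)))
    where
    α%n≡β%n : α %ℕ n ≡ β %ℕ n
    α%n≡β%n = trans (sym (toℕ-fromℕ< _)) (trans (cong toℕ eq) (toℕ-fromℕ< _))
    x-r-[y-r]≡x-y : ∀ x y r → (x - r) - (y - r) ≡ x - y
    x-r-[y-r]≡x-y = solve-∀

  ∣toℕ-toℕ⇒≡ : ∀ {i j : Fin n} → + n ∣ ⟦ i ⟧ - ⟦ j ⟧ → i ≡ j
  ∣toℕ-toℕ⇒≡ {i} {j} n∣i-j = toℕ-injective (+-injective (i-j≡0⇒i≡j _ _ (∣i∣≡0⇒i≡0 ∣i-j∣≡0)))
    where
    ∣i-j∣<n : ∣ ⟦ i ⟧ - ⟦ j ⟧ ∣ ℕ.< n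
    ∣i-j∣<n = subst (λ d → ∣ d ∣ ℕ.< n) (sym (m-n≡m⊖n (toℕ i) (toℕ j)))
      (ℕ.≤-<-trans (∣m⊝n∣≤m⊔n (toℕ i) (toℕ j)) (ℕ.⊔-pres-<m (toℕ<n i) (toℕ<n j)))
    ∣i-j∣≡0 : ∣ ⟦ i ⟧ - ⟦ j ⟧ ∣ ≡ 0
    ∣i-j∣≡0 = trans (sym (m<n⇒m%n≡m ∣i-j∣<n)) (ℕ.n∣m⇒m%n≡0 _ n (∣⇒∣ᵤ n∣i-j))

  ∣toℕ-mod : ∀ {m} (i : Fin m) → + n ∣ ⟦ i ⟧ - ⟦ toℕ i mod n ⟧
  ∣toℕ-mod i = subst (λ r → + n ∣ ⟦ i ⟧ - + r) (sym (toℕ-fromℕ< (m%n<n (toℕ i) n))) (∣-%ℕ ⟦ i ⟧)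

  ⟦combine⟧ : ∀ {m} (s : Fin m) (c : Fin n) → ⟦ combine s c ⟧ ≡ + n * ⟦ s ⟧ + ⟦ c ⟧
  ⟦combine⟧ s c =
    trans (cong +_ (toℕ-combine s c)) (trans (pos-+ _ (toℕ c)) (cong (_+ ⟦ c ⟧) (pos-* n (toℕ s))))

  combine-mod : ∀ {m} (s : Fin m) (c : Fin n) → toℕ (combine s c) mod n ≡ c
  combine-mod s c = toℕ-injective (begin
    toℕ (toℕ (combine s c) mod n)       ≡⟨ toℕ-fromℕ< _ ⟩
    toℕ (combine s c) ℕ.% n             ≡⟨ cong (ℕ._% n) (toℕ-combine s c) ⟩
    (n ℕ.* toℕ s ℕ.+ toℕ c) ℕ.% n       ≡⟨ cong (ℕ._% n) (ℕ.+-comm (n ℕ.* toℕ s) (toℕ c)) ⟩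
    (toℕ c ℕ.+ n ℕ.* toℕ s) ℕ.% n       ≡⟨ cong (λ x → (toℕ c ℕ.+ x) ℕ.% n) (ℕ.*-comm n (toℕ s)) ⟩
    (toℕ c ℕ.+ toℕ s ℕ.* n) ℕ.% n       ≡⟨ [m+kn]%n≡m%n (toℕ c) (toℕ s) n ⟩
    toℕ c ℕ.% n                         ≡⟨ m<n⇒m%n≡m (toℕ<n c) ⟩
    toℕ c                               ∎)
    where open ≡-Reasoning

  combine-quotient : ∀ {m} (i : Fin (m ℕ.* n)) {c} → toℕ i mod n ≡ c → combine (quotient {m} n i) c ≡ i
  combine-quotient {m} i refl =
    trans (cong (combine (quotient {m} n i)) (sym remainder≡mod)) (combine-remQuot {m} n i)
    where
    remainder≡mod : remainder {m} n i ≡ toℕ i mod n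
    remainder≡mod = trans (sym (combine-mod (quotient {m} n i) (remainder {m} n i)))
                          (cong (λ j → toℕ j mod n) (combine-remQuot {m} n i))

module _ {p : ℕ} (pp : Prime p) where
  private instance
    p≢0 : NonZero p
    p≢0 = prime⇒nonZero pp

  ∣*⇒∣⊎∣ : ∀ α β → + p ∣ α * β → (+ p ∣ α) ⊎ (+ p ∣ β)
  ∣*⇒∣⊎∣ α β p∣αβ =
    Sum.map ∣ᵤ⇒∣ ∣ᵤ⇒∣ (euclidsLemma ∣ α ∣ ∣ β ∣ pp (subst (p ℕ.∣_) (abs-* α β) (∣⇒∣ᵤ p∣αβ)))

  affine-cancel : ∀ {α} → ¬ (+ p ∣ α) → ∀ β {t t′ : Fin p} →
                  + p ∣ (β + α * ⟦ t ⟧) - (β + α * ⟦ t′ ⟧) → t ≡ t′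
  affine-cancel {α} p∤α β {t} {t′} p∣difference =
    Sum.[ ⊥-elim ∘ p∤α , ∣toℕ-toℕ⇒≡ ]′
      (∣*⇒∣⊎∣ α (⟦ t ⟧ - ⟦ t′ ⟧) (subst (+ p ∣_) (difference α β ⟦ t ⟧ ⟦ t′ ⟧) p∣difference))
    where
    difference : ∀ a b x y → (b + a * x) - (b + a * y) ≡ a * (x - y)
    difference = solve-∀

  linear-root : ∀ {α} → ¬ (+ p ∣ α) → ∀ β → ∃ λ (t : Fin p) → + p ∣ β + α * ⟦ t ⟧
  linear-root {α} p∤α β =
    let t , rt≡r0 = injective⇒surjective r-injective (residue 0ℤ)
    in t , subst (+ p ∣_) (+-identityʳ _) (residue-≡⇒∣ (β + α * ⟦ t ⟧) 0ℤ rt≡r0)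
    where
    r : Fin p → Fin p
    r t = residue (β + α * ⟦ t ⟧)
    r-injective : Injective _≡_ _≡_ r
    r-injective {t} {t′} = affine-cancel p∤α β ∘ residue-≡⇒∣ (β + α * ⟦ t ⟧) (β + α * ⟦ t′ ⟧)

  linear-root-unique : ∀ {α} → ¬ (+ p ∣ α) → ∀ β {t t′ : Fin p} →
                       + p ∣ β + α * ⟦ t ⟧ → + p ∣ β + α * ⟦ t′ ⟧ → t ≡ t′
  linear-root-unique p∤α β p∣root p∣root′ = affine-cancel p∤α β (∣m∣n⇒∣m-n p∣root p∣root′)

  linear-Enumeration : ∀ {n α} → ¬ (+ p ∣ α) → (β : Fin n → ℤ) →
                       Enumeration (λ (s , t) → + p ∣ β s + α * ⟦ t ⟧) n
  linear-Enumeration p∤α β =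
    graph-Enumeration (λ s → linear-root p∤α (β s)) (λ {s} → linear-root-unique p∤α (β s))

allPairs : ∀ n → List (Pair n)
allPairs n = cartesianProduct (allFin n) (allFin n)

Edge? : ∀ n → Decidable (Edge n)
Edge? n (a , b) (c , d) = n ℕ.∣? ∣ ⟦ a ⟧ * ⟦ d ⟧ - ⟦ b ⟧ * ⟦ c ⟧ - 1ℤ ∣

Edge⇒IsVertex : ∀ {n} {x y : Pair n} → Edge n x y → IsVertex n y
Edge⇒IsVertex {n} {a , b} {c , d} x→y = ℕ.∣1⇒≡1 (∣⇒∣ᵤ g∣1)
  where
  g = gcd (gcd (toℕ c) (toℕ d)) n
  g∣c : + g ∣ ⟦ c ⟧
  g∣c = ∣ᵤ⇒∣ (ℕ.∣-trans (gcd[m,n]∣m (gcd (toℕ c) (toℕ d)) n) (gcd[m,n]∣m (toℕ c) (toℕ d)))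
  g∣d : + g ∣ ⟦ d ⟧
  g∣d = ∣ᵤ⇒∣ (ℕ.∣-trans (gcd[m,n]∣m (gcd (toℕ c) (toℕ d)) n) (gcd[m,n]∣n (toℕ c) (toℕ d)))
  g∣det : + g ∣ ⟦ a ⟧ * ⟦ d ⟧ - ⟦ b ⟧ * ⟦ c ⟧
  g∣det = ∣m∣n⇒∣m-n (∣n⇒∣m*n ⟦ a ⟧ g∣d) (∣n⇒∣m*n ⟦ b ⟧ g∣c)
  g∣det-1 : + g ∣ ⟦ a ⟧ * ⟦ d ⟧ - ⟦ b ⟧ * ⟦ c ⟧ - 1ℤ
  g∣det-1 = ∣-trans (∣ᵤ⇒∣ {+ g} {+ n} (gcd[m,n]∣n (gcd (toℕ c) (toℕ d)) n)) (∣ᵤ⇒∣ x→y)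
  g∣1 : + g ∣ 1ℤ
  g∣1 = ∣m⇒∣-m (∣m+n∣m⇒∣n g∣det-1 g∣det)

IsVertex⇒∤⊎∤ : ∀ {p n} {a b : Fin n} → Prime p → p ℕ.∣ n → IsVertex n (a , b) →
               ¬ (p ℕ.∣ toℕ a) ⊎ ¬ (p ℕ.∣ toℕ b)
IsVertex⇒∤⊎∤ {p} {a = a} {b} pp p∣n gcd≡1 with p ℕ.∣? toℕ a | p ℕ.∣? toℕ b
... | no p∤a  | _       = inj₁ p∤a
... | yes _   | no p∤b  = inj₂ p∤b
... | yes p∣a | yes p∣b = ⊥-elim (¬prime[1] (subst Prime (ℕ.∣1⇒≡1 p∣1) pp))
  where
  p∣1 : p ℕ.∣ 1
  p∣1 = subst (p ℕ.∣_) gcd≡1 (gcd-greatest (gcd-greatest p∣a p∣b) p∣n)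

reduce : ∀ {n} (q : ℕ) .{{_ : NonZero q}} → Pair n → Pair q
reduce q (a , b) = toℕ a mod q , toℕ b mod q

Edge-reduce⇒∣det-1 : ∀ {n q} .{{_ : NonZero q}} {a b : Fin n} {c d : Fin q} →
          Edge q (reduce q (a , b)) (c , d) → + q ∣ ⟦ a ⟧ * ⟦ d ⟧ - ⟦ b ⟧ * ⟦ c ⟧ - 1ℤ
Edge-reduce⇒∣det-1 {q = q} {a} {b} {c} {d} x→y =
  subst (+ q ∣_) (sym (split ⟦ a ⟧ ⟦ b ⟧ ⟦ c ⟧ ⟦ d ⟧ ⟦ a′ ⟧ ⟦ b′ ⟧))
  (∣m∣n⇒∣m+n q∣det′-1 (∣m∣n⇒∣m-n (∣m⇒∣m*n ⟦ d ⟧ (∣toℕ-mod a)) (∣m⇒∣m*n ⟦ c ⟧ (∣toℕ-mod b))))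
  where
  a′ = toℕ a mod q
  b′ = toℕ b mod q
  q∣det′-1 : + q ∣ ⟦ a′ ⟧ * ⟦ d ⟧ - ⟦ b′ ⟧ * ⟦ c ⟧ - 1ℤ
  q∣det′-1 = ∣ᵤ⇒∣ x→y
  split : ∀ a b c d a′ b′ → a * d - b * c - 1ℤ ≡ (a′ * d - b′ * c - 1ℤ) + ((a - a′) * d - (b - b′) * c)
  split = solve-∀

module EdgeLifting {p : ℕ} (pp : Prime p) (q : ℕ) .{{_ : NonZero q}} where

  EdgeLift : Pair (p ℕ.* q) → Pair q → Pair (p ℕ.* q) → Set
  EdgeLift x y z = Edge (p ℕ.* q) x z × reduce q z ≡ y

  edgeLift? : ∀ x y z → Dec (EdgeLift x y z)
  edgeLift? x y z = Edge? _ x z ×-dec ≡-dec _≟_ _≟_ (reduce q z) y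

  +pq≡+q*+p : + (p ℕ.* q) ≡ + q * + p
  +pq≡+q*+p = trans (pos-* p q) (*-comm (+ p) (+ q))

  module _ {a b : Fin (p ℕ.* q)} {c d : Fin q} (θx→y : Edge q (reduce q (a , b)) (c , d)) where

    K : ℤ
    K = _∣_.quotient (Edge-reduce⇒∣det-1 θx→y)

    lift : Fin p × Fin p → Pair (p ℕ.* q)
    lift (s , t) = combine s c , combine t d

    lift-injective : Injective _≡_ _≡_ lift
    lift-injective {s , t} {s′ , t′} eq =
      cong₂ _,_ (combine-injectiveˡ s c s′ c (cong proj₁ eq)) (combine-injectiveˡ t d t′ d (cong proj₂ eq))

    reduce-lift : ∀ s t → reduce q (lift (s , t)) ≡ (c , d)
    reduce-lift s t = cong₂ _,_ (combine-mod s c) (combine-mod t d)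

    Solution : Fin p × Fin p → Set
    Solution (s , t) = + p ∣ K + ⟦ a ⟧ * ⟦ t ⟧ - ⟦ b ⟧ * ⟦ s ⟧

    det-1-lift : ∀ (s t : Fin p) → ⟦ a ⟧ * ⟦ combine t d ⟧ - ⟦ b ⟧ * ⟦ combine s c ⟧ - 1ℤ ≡
                         + q * (K + ⟦ a ⟧ * ⟦ t ⟧ - ⟦ b ⟧ * ⟦ s ⟧)
    det-1-lift s t = begin
      A * ⟦ combine t d ⟧ - B * ⟦ combine s c ⟧ - 1ℤ
        ≡⟨ cong₂ (λ x y → A * x - B * y - 1ℤ) (⟦combine⟧ t d) (⟦combine⟧ s c) ⟩
      A * (Q * T + D) - B * (Q * S + C) - 1ℤ
        ≡⟨ expand A B C D Q S T ⟩
      (A * D - B * C - 1ℤ) + Q * (A * T - B * S)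
        ≡⟨ cong (_+ Q * (A * T - B * S)) (_∣_.equality (Edge-reduce⇒∣det-1 θx→y)) ⟩
      K * Q + Q * (A * T - B * S)
        ≡⟨ factor K A B Q S T ⟩
      Q * (K + A * T - B * S)
        ∎
      where
      open ≡-Reasoning
      A = ⟦ a ⟧; B = ⟦ b ⟧; C = ⟦ c ⟧; D = ⟦ d ⟧; Q = + q; S = ⟦ s ⟧; T = ⟦ t ⟧
      expand : ∀ a b c d q s t →
               a * (q * t + d) - b * (q * s + c) - 1ℤ ≡ (a * d - b * c - 1ℤ) + q * (a * t - b * s)
      expand = solve-∀
      factor : ∀ k a b q s t → k * q + q * (a * t - b * s) ≡ q * (k + a * t - b * s)
      factor = solve-∀

    solutions : ¬ (p ℕ.∣ toℕ a) ⊎ ¬ (p ℕ.∣ toℕ b) → Enumeration Solution p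
    solutions (inj₁ p∤a) =
      Enumeration-image id id
        (λ {(s , t)} → subst (+ p ∣_) (regroupᵃ K ⟦ a ⟧ ⟦ b ⟧ ⟦ s ⟧ ⟦ t ⟧))
        (λ {(s , t)} → subst (+ p ∣_) (sym (regroupᵃ K ⟦ a ⟧ ⟦ b ⟧ ⟦ s ⟧ ⟦ t ⟧)))
        (λ {x} _ → x , refl)
        (linear-Enumeration pp {α = ⟦ a ⟧} (p∤a ∘ ∣⇒∣ᵤ) (λ s → K - ⟦ b ⟧ * ⟦ s ⟧))
      where
      regroupᵃ : ∀ k a b s t → (k - b * s) + a * t ≡ k + a * t - b * s
      regroupᵃ = solve-∀
    solutions (inj₂ p∤b) =
      Enumeration-image swap (cong swap)
        (λ {(t , s)} → subst (+ p ∣_) (regroupᵇ K ⟦ a ⟧ ⟦ b ⟧ ⟦ s ⟧ ⟦ t ⟧))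
        (λ {(t , s)} → subst (+ p ∣_) (sym (regroupᵇ K ⟦ a ⟧ ⟦ b ⟧ ⟦ s ⟧ ⟦ t ⟧)))
        (λ {x} _ → swap x , refl)
        (linear-Enumeration pp {α = - ⟦ b ⟧} (p∤b ∘ subst (p ℕ.∣_) (∣-i∣≡∣i∣ ⟦ b ⟧) ∘ ∣⇒∣ᵤ)
                                              (λ t → K + ⟦ a ⟧ * ⟦ t ⟧))
      where
      regroupᵇ : ∀ k a b s t → (k + a * t) + (- b) * s ≡ k + a * t - b * s
      regroupᵇ = solve-∀

    Solution⇒EdgeLift : ∀ {x} → Solution x → EdgeLift (a , b) (c , d) (lift x)
    Solution⇒EdgeLift {s , t} sol =
      ∣⇒∣ᵤ {+ (p ℕ.* q)} (subst₂ _∣_ (sym +pq≡+q*+p) (sym (det-1-lift s t)) (*-monoʳ-∣ (+ q) sol)) ,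
      reduce-lift s t

    EdgeLift⇒Solution : ∀ {x} → EdgeLift (a , b) (c , d) (lift x) → Solution x
    EdgeLift⇒Solution {s , t} (x→z , _) =
      *-cancelˡ-∣ (+ q) (subst₂ _∣_ +pq≡+q*+p (det-1-lift s t) (∣ᵤ⇒∣ {+ (p ℕ.* q)} x→z))

    EdgeLift⇒lift : ∀ {z} → EdgeLift (a , b) (c , d) z → ∃ λ x → lift x ≡ z
    EdgeLift⇒lift {c′ , d′} (_ , reduce≡) = (quotient {p} q c′ , quotient {p} q d′) ,
      cong₂ _,_ (combine-quotient {m = p} c′ (cong proj₁ reduce≡))
                (combine-quotient {m = p} d′ (cong proj₂ reduce≡))

    lift-Enumeration : IsVertex (p ℕ.* q) (a , b) → Enumeration (EdgeLift (a , b) (c , d)) p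
    lift-Enumeration x-vertex =
      Enumeration-image lift lift-injective Solution⇒EdgeLift EdgeLift⇒Solution EdgeLift⇒lift
        (solutions (IsVertex⇒∤⊎∤ pp (ℕ.m∣m*n q) x-vertex))

  edgeLifts : Pair (p ℕ.* q) → Pair q → List (Pair (p ℕ.* q))
  edgeLifts x y = filter (edgeLift? x y) (allPairs (p ℕ.* q))

  edgeLifts-unique : ∀ x y → Unique (edgeLifts x y)
  edgeLifts-unique x y =
    Unique.filter⁺ (edgeLift? x y) (Unique.cartesianProduct⁺ (Unique.allFin⁺ _) (Unique.allFin⁺ _))

  ∈-edgeLifts⇔ : ∀ {x y z} → z ∈ edgeLifts x y ⇔ EdgeLift x y z
  ∈-edgeLifts⇔ {x} {y} {z@(c , d)} = mk⇔ (proj₂ ∘ ∈-filter⁻ (edgeLift? x y) {xs = allPairs _})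
    (∈-filter⁺ (edgeLift? x y) (∈-cartesianProduct⁺ (∈-allFin c) (∈-allFin d)))

  length-edgeLifts : ∀ {x y} → IsVertex (p ℕ.* q) x → Edge q (reduce q x) y → length (edgeLifts x y) ≡ p
  length-edgeLifts {x@(a , b)} {y@(c , d)} x-vertex θx→y =
    Enumeration⇒length≡ (edgeLifts-unique x y) (∈-edgeLifts⇔ {x} {y})
                        (lift-Enumeration {a} {b} {c} {d} θx→y x-vertex)

module PathLifting {p : ℕ} (pp : Prime p) (k : ℕ) where
  private instance
    p≢0 : NonZero p
    p≢0 = prime⇒nonZero pp
    pᵏ≢0 : NonZero (p ^ k)
    pᵏ≢0 = ℕ.m^n≢0 p k

  -- θ pp (suc k) is definitionally reduce (p ^ k).
  open EdgeLifting pp (p ^ k)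

  pathLifts : ∀ {m} → Vec (Pair (p ^ k)) (suc m) → Pair (p ^ suc k) → List (Vec (Pair (p ^ suc k)) (suc m))
  pathLifts (_ ∷ [])     v = (v ∷ []) ∷ []
  pathLifts (_ ∷ y ∷ ys) v = concatMap (λ z → map (v ∷_) (pathLifts (y ∷ ys) z)) (edgeLifts v y)

  ∈-pathLifts⇒head≡ : ∀ {m} (γ : Vec (Pair (p ^ k)) (suc m)) {v w} → w ∈ pathLifts γ v → head w ≡ v
  ∈-pathLifts⇒head≡ (_ ∷ [])     (here refl) = refl
  ∈-pathLifts⇒head≡ (_ ∷ y ∷ ys) {v} w∈ =
    let _ , _ , w∈v∷lifts = find (∈-concatMap⁻ _ {xs = edgeLifts v y} w∈)
        _ , _ , w≡v∷w′ = ∈-map⁻ (v ∷_) w∈v∷lifts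
    in cong head w≡v∷w′

  ∈-pathLifts-∷⁻ : ∀ {m y₀ y} {ys : Vec (Pair (p ^ k)) m} {v w₀ w} → (w₀ ∷ w) ∈ pathLifts (y₀ ∷ y ∷ ys) v →
                   w₀ ≡ v × head w ∈ edgeLifts v y × w ∈ pathLifts (y ∷ ys) (head w)
  ∈-pathLifts-∷⁻ {y = y} {ys} {v} w∈ with find (∈-concatMap⁻ _ {xs = edgeLifts v y} w∈)
  ... | _ , z∈ , w∈v∷lifts with ∈-map⁻ (v ∷_) w∈v∷lifts
  ... | w′ , w′∈ , refl with ∈-pathLifts⇒head≡ (y ∷ ys) w′∈
  ... | refl = refl , z∈ , w′∈

  pathLifts-unique : ∀ {m} (γ : Vec (Pair (p ^ k)) (suc m)) v → Unique (pathLifts γ v)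
  pathLifts-unique (_ ∷ [])     v = All.[] ∷ []
  pathLifts-unique (_ ∷ y ∷ ys) v = Unique-concatMap _ (edgeLifts-unique v y)
    (λ z → Unique.map⁺ ∷-injectiveʳ (pathLifts-unique (y ∷ ys) z))
    (λ w∈ w∈′ → trans (sym (head∘tail≡ w∈)) (head∘tail≡ w∈′))
    where
    head∘tail≡ : ∀ {z w} → w ∈ map (v ∷_) (pathLifts (y ∷ ys) z) → head (tail w) ≡ z
    head∘tail≡ w∈ = let _ , w′∈ , w≡v∷w′ = ∈-map⁻ (v ∷_) w∈
                    in trans (cong (head ∘ tail) w≡v∷w′) (∈-pathLifts⇒head≡ (y ∷ ys) w′∈)

  length-pathLifts : ∀ {m} {γ : Vec (Pair (p ^ k)) (suc m)} {v} → IsPath (p ^ k) γ →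
                     IsVertex (p ^ suc k) v → θ pp (suc k) v ≡ head γ → length (pathLifts γ v) ≡ p ^ m
  length-pathLifts {γ = _ ∷ []} _ _ _ = refl
  length-pathLifts {suc m} {y₀ ∷ y ∷ ys} {v} ((_ , ys-vertices) , (y₀→y , ys-chain)) v-vertex θv≡y₀ = begin
    length (pathLifts (y₀ ∷ y ∷ ys) v)
      ≡⟨ length-concatMap (λ z → map (v ∷_) (pathLifts (y ∷ ys) z)) lifts-through ⟩
    length (edgeLifts v y) ℕ.* p ^ m
      ≡⟨ cong (ℕ._* p ^ m) (length-edgeLifts {v} {y} v-vertex θv→y) ⟩
    p ℕ.* p ^ m
      ∎
    where
    open ≡-Reasoning
    θv→y : Edge (p ^ k) (θ pp (suc k) v) y
    θv→y = subst (λ u → Edge (p ^ k) u y) (sym θv≡y₀) y₀→y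
    lifts-through : ∀ {z} → z ∈ edgeLifts v y → length (map (v ∷_) (pathLifts (y ∷ ys) z)) ≡ p ^ m
    lifts-through z∈ = let v→z , θz≡y = Equivalence.to (∈-edgeLifts⇔ {v} {y}) z∈ in
      trans (length-map _ (pathLifts (y ∷ ys) _))
            (length-pathLifts (ys-vertices , ys-chain) (Edge⇒IsVertex {x = v} v→z) θz≡y)

  ∈-pathLifts⇒IsLift : ∀ {m} {γ : Vec (Pair (p ^ k)) (suc m)} {v w} → IsVertex (p ^ suc k) v →
                       θ pp (suc k) v ≡ head γ → w ∈ pathLifts γ v → IsLift pp (suc k) γ w
  ∈-pathLifts⇒IsLift {γ = _ ∷ []} v-vertex θv≡y (here refl) = ((v-vertex , tt) , tt) , cong (_∷ []) θv≡y
  ∈-pathLifts⇒IsLift {γ = y₀ ∷ y ∷ ys} {v} {_ ∷ w₁ ∷ _} v-vertex θv≡y₀ w∈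
    with ∈-pathLifts-∷⁻ {y₀ = y₀} {ys = ys} w∈
  ... | refl , w₁∈ , w∈′ =
    let v→w₁ , θw₁≡y = Equivalence.to (∈-edgeLifts⇔ {v} {y}) w₁∈
        (w-vertices , w-chain) , θ*w≡ys = ∈-pathLifts⇒IsLift (Edge⇒IsVertex {x = v} v→w₁) θw₁≡y w∈′
    in ((v-vertex , w-vertices) , (v→w₁ , w-chain)) , cong₂ _∷_ θv≡y₀ θ*w≡ys

  IsLift⇒∈-pathLifts : ∀ {m} {γ : Vec (Pair (p ^ k)) (suc m)} {w} →
                       IsLift pp (suc k) γ w → w ∈ pathLifts γ (head w)
  IsLift⇒∈-pathLifts {γ = _ ∷ []}     {_ ∷ []} _ = here refl
  IsLift⇒∈-pathLifts {γ = _ ∷ y ∷ ys} {w₀ ∷ w₁ ∷ ws} (((_ , w-vertices) , (w₀→w₁ , w-chain)) , θ*w≡γ) =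
    ∈-concatMap⁺ _ {xs = edgeLifts w₀ y} (lose w₁∈ (∈-map⁺ (w₀ ∷_) w∈))
    where
    θ*w≡ys : θ* pp (suc k) (w₁ ∷ ws) ≡ y ∷ ys
    θ*w≡ys = ∷-injectiveʳ θ*w≡γ
    w₁∈ : w₁ ∈ edgeLifts w₀ y
    w₁∈ = Equivalence.from (∈-edgeLifts⇔ {w₀} {y}) (w₀→w₁ , ∷-injectiveˡ θ*w≡ys)
    w∈ : (w₁ ∷ ws) ∈ pathLifts (y ∷ ys) w₁
    w∈ = IsLift⇒∈-pathLifts ((w-vertices , w-chain) , θ*w≡ys)

  ∈-pathLifts⇔ : ∀ {m} {γ : Vec (Pair (p ^ k)) (suc m)} {v} →
                 IsVertex (p ^ suc k) v → θ pp (suc k) v ≡ head γ →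
                 ∀ w → w ∈ pathLifts γ v ⇔ (IsLift pp (suc k) γ w × head w ≡ v)
  ∈-pathLifts⇔ {γ = γ} {v} v-vertex θv≡y₀ w = mk⇔ ∈⇒ ⇒∈
    where
    ∈⇒ : w ∈ pathLifts γ v → IsLift pp (suc k) γ w × head w ≡ v
    ∈⇒ w∈ = ∈-pathLifts⇒IsLift v-vertex θv≡y₀ w∈ , ∈-pathLifts⇒head≡ γ w∈
    ⇒∈ : IsLift pp (suc k) γ w × head w ≡ v → w ∈ pathLifts γ v
    ⇒∈ (w-lift , refl) = IsLift⇒∈-pathLifts w-lift

lemma2 : (p : ℕ) (pp : Prime p) (r : ℕ) → 1 ≤ r → (m : ℕ)
    → (γ : Vec (Pair (p ^ (r ∸ 1))) (suc m)) → IsPath (p ^ (r ∸ 1)) γ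
    → (v̄ : Pair (p ^ r)) → IsVertex (p ^ r) v̄ → θ pp r v̄ ≡ head γ
    → Σ (List (Vec (Pair (p ^ r)) (suc m))) (λ L →
        Unique L × length L ≡ p ^ m
        × ((w : Vec (Pair (p ^ r)) (suc m)) → (w ∈ L ⇔ (IsLift pp r γ w × head w ≡ v̄))))
lemma2 _ _  zero    ()
lemma2 p pp (suc k) _ m γ γ-path v̄ v̄-vertex θv̄≡γ₀ =
  pathLifts γ v̄ ,
  pathLifts-unique γ v̄ ,
  length-pathLifts γ-path v̄-vertex θv̄≡γ₀ ,
  ∈-pathLifts⇔ v̄-vertex θv̄≡γ₀
  where open PathLifting pp k
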